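{- For all integers $n,m\geq0$ and $p\ge 0$, \[ \sum_{k=0}^{m}s(m,k)\,\mathcal{B}_{n+k,p}=\sum_{k=0}^{n}\genfrac{\{}{\}}{0pt}{}{n+m}{k+m}_{m}\binom{m+k+p}{p}^{ -1}. \]
   Context: $s(m,k)$ are the signed Stirling numbers of the first kind, defined by $x(x-1)\cdots(x-m+1)=\sum_{k=0}^m s(m,k)x^k$. The $r$-Stirling numbers of the second kind $\genfrac{\{}{\}}{0pt}{}{n}{k}_{r}$ count partitions of an $n$-element set $\{1,\dots,n\}$ into exactly $k$ nonempty blocks such that the elements $1,\dots,r$ lie in distinct blocks; equivalently $\sum_{n\ge k}\genfrac{\{}{\}}{0pt}{}{n+r}{k+r}_r\frac{z^n}{n!}=\frac{1}{k!}e^{rz}(e^z-1)^k$. For an integer $p\ge0$, the $p$-Bell numbers $\mathcal{B}_{n,p}$ are defined by $\sum_{n\geq0}\mathcal{B}_{n,p}\frac{z^{n}}{n!}=\sum_{k\geq0}\binom{k+p}{p}^{ -1}\frac{(e^{z}-1)^{k}}{k!}$ (this equals ${}_1F_1(1;p+1;e^z-1)$). -}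

module Defs where

open import Data.Nat as ℕ using (ℕ; zero; suc)
open import Data.Nat.Combinatorics using (_C_)
open import Data.Integer as ℤ using (ℤ; +_)
open import Data.Rational as ℚ using (ℚ; 0ℚ; _/_)

-- Σ_{k=0}^{n} f k  (inclusive upper bound)
sumTo : ℕ → (ℕ → ℚ) → ℚ
sumTo zero    f = f 0
sumTo (suc n) f = sumTo n f ℚ.+ f (suc n)

ℤtoℚ : ℤ → ℚ
ℤtoℚ z = z / 1

ℕtoℚ : ℕ → ℚ
ℕtoℚ n = (+ n) / 1

-- reciprocal of a natural number (only ever applied to binomials ≥ 1;
-- the value at 0 is an irrelevant convention)
invℕ : ℕ → ℚ
invℕ zero    = 0ℚ
invℕ (suc n) = (+ 1) / suc n

-- signed Stirling numbers of the first kind s(m,k):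
-- x(x-1)...(x-m+1) = Σ_k s(m,k) x^k, i.e. multiplying by (x - m):
-- s(m+1,k+1) = s(m,k) - m s(m,k+1)
stir1 : ℕ → ℕ → ℤ
stir1 zero    zero    = + 1
stir1 zero    (suc k) = + 0
stir1 (suc m) zero    = + 0
stir1 (suc m) (suc k) = stir1 m k ℤ.- (+ m) ℤ.* stir1 m (suc k)

-- Stirling numbers of the second kind S(n,k) (coefficients of (e^z-1)^k/k!)
stir2 : ℕ → ℕ → ℕ
stir2 zero    zero    = 1
stir2 zero    (suc k) = 0
stir2 (suc n) zero    = 0
stir2 (suc n) (suc k) = suc k ℕ.* stir2 n (suc k) ℕ.+ stir2 n k

-- rStir r n k = {n+r \brace k+r}_r, read off the EGF
--   Σ_n {n+r \brace k+r}_r z^n/n! = e^{rz} (e^z-1)^k / k!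
-- as the Cauchy product: Σ_{j=0}^{n} C(n,j) r^(n-j) S(j,k).
rStirSum : ℕ → ℕ → ℕ → ℕ → ℕ
rStirSum r n k zero    = (n C 0) ℕ.* (r ℕ.^ n) ℕ.* stir2 0 k
rStirSum r n k (suc j) = rStirSum r n k j ℕ.+ (n C suc j) ℕ.* (r ℕ.^ (n ℕ.∸ suc j)) ℕ.* stir2 (suc j) k

rStir : ℕ → ℕ → ℕ → ℕ
rStir r n k = rStirSum r n k n

-- p-Bell numbers: coefficient of z^n/n! in Σ_k C(k+p,p)^{-1} (e^z-1)^k/k!,
-- i.e. B_{n,p} = Σ_{k=0}^{n} S(n,k) / C(k+p,p)
pBell : ℕ → ℕ → ℚ
pBell n p = sumTo n (λ k → ℕtoℚ (stir2 n k) ℚ.* invℕ ((k ℕ.+ p) C p))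

module Submission where

-- Idea of the proof.  Write S(n,j) for the Stirling numbers of the second
-- kind and c j = C(j+p,p)⁻¹, so that B_{n,p} = Σ_j S(n,j) c j.  Then
--
--   Σ_k s(m,k) B_{n+k,p} = Σ_j T(m,n,j) c j,   T(m,n,j) = Σ_k s(m,k) S(n+k,j),
--
-- and T(m,n,j) (called fallCoeff below) is the coefficient of the falling factorial (x)_j in
-- x^n (x)_m.  The theorem therefore reduces to two facts about T:
--   * T(m,n,j) = 0 for j < m, and
--   * T(m,n,m+i) = {n+m \brace i+m}_m.
-- Both follow from the recurrences of T in n (from the recurrence of S) and
-- in m (from s(m+1,k+1) = s(m,k) - m s(m,k+1)), by comparing with the
-- recurrence of the r-Stirling numbers, which we derive from their
-- definition as the binomial convolution Σ_j C(n,j) r^(n-j) S(j,k).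

open import Defs
open import Data.Nat using (ℕ; _+_)
open import Data.Nat.Combinatorics using (_C_)
open import Data.Rational using (_*_)
open import Relation.Binary.PropositionalEquality using (_≡_)

open import Data.Nat as ℕ using (zero; suc; _∸_; _^_; _≤_; _<_; _≤′_; ≤′-refl; ≤′-step; z≤n; s≤s)
import Data.Nat.Properties as ℕP
open import Data.Nat.Combinatorics using (nCk+nC[k+1]≡[n+1]C[k+1])
open import Data.Nat.Combinatorics.Specification using (k>n⇒nCk≡0)
import Data.Nat.Tactic.RingSolver as ℕSolver
open import Data.Integer as ℤ using (ℤ; +_)
import Data.Integer.Properties as ℤP
open import Data.Integer.Tactic.RingSolver using (solve-∀)
open import Data.Rational as ℚ using (ℚ; -_; 0ℚ) renaming (_+_ to _⊕_; _-_ to _⊖_)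
import Data.Rational.Properties as ℚP
open import Data.Rational.Unnormalised as ℚᵘ using (ℚᵘ; mkℚᵘ; *≡*)
import Data.Rational.Unnormalised.Properties as ℚᵘP
open import Data.Rational.Solver using (module +-*-Solver)
open +-*-Solver using (_:+_; _:*_; _:-_; _:=_; con) renaming (solve to qsolve)
open import Data.Sum using (inj₁; inj₂)
open import Relation.Nullary using (yes; no)
open import Relation.Binary.PropositionalEquality using (refl; sym; trans; cong; cong₂; subst; module ≡-Reasoning)
open ≡-Reasoning

fromℚᵘ-+ : ∀ p q → ℚ.fromℚᵘ (p ℚᵘ.+ q) ≡ ℚ.fromℚᵘ p ⊕ ℚ.fromℚᵘ q
fromℚᵘ-+ p q = ℚP.toℚᵘ-injective (ℚᵘP.≃-trans (ℚP.toℚᵘ-fromℚᵘ (p ℚᵘ.+ q)) (ℚᵘP.≃-sym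
  (ℚᵘP.≃-trans (ℚP.toℚᵘ-homo-+ (ℚ.fromℚᵘ p) (ℚ.fromℚᵘ q))
               (ℚᵘP.+-cong (ℚP.toℚᵘ-fromℚᵘ p) (ℚP.toℚᵘ-fromℚᵘ q)))))

fromℚᵘ-* : ∀ p q → ℚ.fromℚᵘ (p ℚᵘ.* q) ≡ ℚ.fromℚᵘ p * ℚ.fromℚᵘ q
fromℚᵘ-* p q = ℚP.toℚᵘ-injective (ℚᵘP.≃-trans (ℚP.toℚᵘ-fromℚᵘ (p ℚᵘ.* q)) (ℚᵘP.≃-sym
  (ℚᵘP.≃-trans (ℚP.toℚᵘ-homo-* (ℚ.fromℚᵘ p) (ℚ.fromℚᵘ q))
               (ℚᵘP.*-cong (ℚP.toℚᵘ-fromℚᵘ p) (ℚP.toℚᵘ-fromℚᵘ q)))))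

fromℚᵘ-neg : ∀ p → ℚ.fromℚᵘ (ℚᵘ.- p) ≡ - ℚ.fromℚᵘ p
fromℚᵘ-neg p = ℚP.toℚᵘ-injective (ℚᵘP.≃-trans (ℚP.toℚᵘ-fromℚᵘ (ℚᵘ.- p)) (ℚᵘP.≃-sym
  (ℚᵘP.≃-trans (ℚP.toℚᵘ-homo‿- (ℚ.fromℚᵘ p)) (ℚᵘP.-‿cong (ℚP.toℚᵘ-fromℚᵘ p)))))

ℤtoℚᵘ : ℤ → ℚᵘ
ℤtoℚᵘ a = mkℚᵘ a 0

ℤtoℚ-+ : ∀ a b → ℤtoℚ (a ℤ.+ b) ≡ ℤtoℚ a ⊕ ℤtoℚ b
ℤtoℚ-+ a b = trans (ℚP.fromℚᵘ-cong {ℤtoℚᵘ (a ℤ.+ b)} {ℤtoℚᵘ a ℚᵘ.+ ℤtoℚᵘ b} (*≡* (cross a b)))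
                   (fromℚᵘ-+ (ℤtoℚᵘ a) (ℤtoℚᵘ b))
  where
  cross : ∀ a b → (a ℤ.+ b) ℤ.* (+ 1 ℤ.* + 1) ≡ (a ℤ.* + 1 ℤ.+ b ℤ.* + 1) ℤ.* + 1
  cross = solve-∀

ℤtoℚ-* : ∀ a b → ℤtoℚ (a ℤ.* b) ≡ ℤtoℚ a * ℤtoℚ b
ℤtoℚ-* a b = trans (ℚP.fromℚᵘ-cong {ℤtoℚᵘ (a ℤ.* b)} {ℤtoℚᵘ a ℚᵘ.* ℤtoℚᵘ b} (*≡* (cross a b)))
                   (fromℚᵘ-* (ℤtoℚᵘ a) (ℤtoℚᵘ b))
  where
  cross : ∀ a b → (a ℤ.* b) ℤ.* (+ 1 ℤ.* + 1) ≡ (a ℤ.* b) ℤ.* + 1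
  cross = solve-∀

ℤtoℚ-- : ∀ a b → ℤtoℚ (a ℤ.- b) ≡ ℤtoℚ a ⊖ ℤtoℚ b
ℤtoℚ-- a b = trans (ℤtoℚ-+ a (ℤ.- b)) (cong (ℤtoℚ a ⊕_) (fromℚᵘ-neg (ℤtoℚᵘ b)))

ℕtoℚ-+ : ∀ a b → ℕtoℚ (a + b) ≡ ℕtoℚ a ⊕ ℕtoℚ b
ℕtoℚ-+ a b = trans (cong ℤtoℚ (ℤP.pos-+ a b)) (ℤtoℚ-+ (+ a) (+ b))

ℕtoℚ-* : ∀ a b → ℕtoℚ (a ℕ.* b) ≡ ℕtoℚ a * ℕtoℚ b
ℕtoℚ-* a b = trans (cong ℤtoℚ (ℤP.pos-* a b)) (ℤtoℚ-* (+ a) (+ b))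

sumTo-cong : ∀ n {f g : ℕ → ℚ} → (∀ k → k ≤ n → f k ≡ g k) → sumTo n f ≡ sumTo n g
sumTo-cong zero    f≡g = f≡g 0 z≤n
sumTo-cong (suc n) f≡g = cong₂ _⊕_ (sumTo-cong n (λ k k≤n → f≡g k (ℕP.m≤n⇒m≤1+n k≤n))) (f≡g (suc n) ℕP.≤-refl)

sumTo-+ : ∀ n (f g : ℕ → ℚ) → sumTo n (λ k → f k ⊕ g k) ≡ sumTo n f ⊕ sumTo n g
sumTo-+ zero    f g = refl
sumTo-+ (suc n) f g = trans (cong (_⊕ (f (suc n) ⊕ g (suc n))) (sumTo-+ n f g))
  (qsolve 4 (λ a b c d → (a :+ b) :+ (c :+ d) := (a :+ c) :+ (b :+ d)) refl
    (sumTo n f) (sumTo n g) (f (suc n)) (g (suc n)))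

sumTo-*l : ∀ n c (f : ℕ → ℚ) → sumTo n (λ k → c * f k) ≡ c * sumTo n f
sumTo-*l zero    c f = refl
sumTo-*l (suc n) c f = trans (cong (_⊕ c * f (suc n)) (sumTo-*l n c f)) (sym (ℚP.*-distribˡ-+ c (sumTo n f) (f (suc n))))

sumTo-*r : ∀ n c (f : ℕ → ℚ) → sumTo n (λ k → f k * c) ≡ sumTo n f * c
sumTo-*r n c f = trans (sumTo-cong n (λ k _ → ℚP.*-comm (f k) c)) (trans (sumTo-*l n c f) (ℚP.*-comm c (sumTo n f)))

sumTo-neg : ∀ n (f : ℕ → ℚ) → sumTo n (λ k → - f k) ≡ - sumTo n f
sumTo-neg zero    f = refl
sumTo-neg (suc n) f = trans (cong (_⊕ - f (suc n)) (sumTo-neg n f)) (sym (ℚP.neg-distrib-+ (sumTo n f) (f (suc n))))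

sumTo-- : ∀ n (f g : ℕ → ℚ) → sumTo n (λ k → f k ⊖ g k) ≡ sumTo n f ⊖ sumTo n g
sumTo-- n f g = trans (sumTo-+ n f (λ k → - g k)) (cong (sumTo n f ⊕_) (sumTo-neg n g))

sumTo-zero : ∀ n (f : ℕ → ℚ) → (∀ k → f k ≡ 0ℚ) → sumTo n f ≡ 0ℚ
sumTo-zero zero    f f≡0 = f≡0 0
sumTo-zero (suc n) f f≡0 = cong₂ _⊕_ (sumTo-zero n f f≡0) (f≡0 (suc n))

sumTo-shift : ∀ n (f : ℕ → ℚ) → sumTo (suc n) f ≡ f 0 ⊕ sumTo n (λ k → f (suc k))
sumTo-shift zero    f = refl
sumTo-shift (suc n) f = trans (cong (_⊕ f (suc (suc n))) (sumTo-shift n f))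
  (ℚP.+-assoc (f 0) (sumTo n (λ k → f (suc k))) (f (suc (suc n))))

sumTo-shiftDown : ∀ n (f : ℕ → ℚ) → f (suc n) ≡ 0ℚ → sumTo n (λ k → f (suc k)) ≡ sumTo n f ⊖ f 0
sumTo-shiftDown n f top = begin
  A                              ≡⟨ qsolve 2 (λ a t → a := t :+ a :- t) refl A (f 0) ⟩
  f 0 ⊕ A ⊖ f 0                  ≡⟨ cong (_⊖ f 0) (sym (sumTo-shift n f)) ⟩
  sumTo n f ⊕ f (suc n) ⊖ f 0    ≡⟨ cong (λ x → sumTo n f ⊕ x ⊖ f 0) top ⟩
  sumTo n f ⊕ 0ℚ ⊖ f 0           ≡⟨ cong (_⊖ f 0) (ℚP.+-identityʳ (sumTo n f)) ⟩
  sumTo n f ⊖ f 0                ∎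
  where
  A : ℚ
  A = sumTo n (λ k → f (suc k))

sumTo-extend : ∀ {a b} (f : ℕ → ℚ) → a ≤ b → (∀ j → a < j → f j ≡ 0ℚ) → sumTo b f ≡ sumTo a f
sumTo-extend {a} f a≤b vanish = go (ℕP.≤⇒≤′ a≤b)
  where
  go : ∀ {b} → a ≤′ b → sumTo b f ≡ sumTo a f
  go ≤′-refl          = refl
  go (≤′-step {b} a≤′b) =
    trans (cong₂ _⊕_ (go a≤′b) (vanish (suc b) (s≤s (ℕP.≤′⇒≤ a≤′b)))) (ℚP.+-identityʳ (sumTo a f))

sumTo-dropZeros : ∀ m n (g : ℕ → ℚ) → (∀ j → j < m → g j ≡ 0ℚ) → sumTo (m + n) g ≡ sumTo n (λ i → g (m + i))
sumTo-dropZeros zero    n g vanish = refl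
sumTo-dropZeros (suc m) n g vanish = begin
  sumTo (suc (m + n)) g                      ≡⟨ sumTo-shift (m + n) g ⟩
  g 0 ⊕ sumTo (m + n) (λ k → g (suc k))
    ≡⟨ cong₂ _⊕_ (vanish 0 (s≤s z≤n)) (sumTo-dropZeros m n (λ k → g (suc k)) (λ j j<m → vanish (suc j) (s≤s j<m))) ⟩
  0ℚ ⊕ sumTo n (λ i → g (suc m + i))         ≡⟨ ℚP.+-identityˡ _ ⟩
  sumTo n (λ i → g (suc m + i))              ∎

sumTo-swap : ∀ a b (f : ℕ → ℕ → ℚ) → sumTo a (λ i → sumTo b (λ j → f i j)) ≡ sumTo b (λ j → sumTo a (λ i → f i j))
sumTo-swap zero    b f = refl
sumTo-swap (suc a) b f = begin
  sumTo a (λ i → sumTo b (λ j → f i j)) ⊕ sumTo b (λ j → f (suc a) j)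
    ≡⟨ cong (_⊕ sumTo b (λ j → f (suc a) j)) (sumTo-swap a b f) ⟩
  sumTo b (λ j → sumTo a (λ i → f i j)) ⊕ sumTo b (λ j → f (suc a) j)
    ≡⟨ sym (sumTo-+ b _ _) ⟩
  sumTo b (λ j → sumTo (suc a) (λ i → f i j)) ∎

sumTo-interchange : ∀ a b (s : ℕ → ℚ) (A : ℕ → ℕ → ℚ) (c : ℕ → ℚ) →
  sumTo a (λ k → s k * sumTo b (λ j → A k j * c j)) ≡ sumTo b (λ j → sumTo a (λ k → s k * A k j) * c j)
sumTo-interchange a b s A c = begin
  sumTo a (λ k → s k * sumTo b (λ j → A k j * c j))
    ≡⟨ sumTo-cong a (λ k _ → sym (sumTo-*l b (s k) (λ j → A k j * c j))) ⟩
  sumTo a (λ k → sumTo b (λ j → s k * (A k j * c j)))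
    ≡⟨ sumTo-swap a b (λ k j → s k * (A k j * c j)) ⟩
  sumTo b (λ j → sumTo a (λ k → s k * (A k j * c j)))
    ≡⟨ sumTo-cong b (λ j _ → trans (sumTo-cong a (λ k _ → sym (ℚP.*-assoc (s k) (A k j) (c j))))
                                   (sumTo-*r a (c j) (λ k → s k * A k j))) ⟩
  sumTo b (λ j → sumTo a (λ k → s k * A k j) * c j) ∎

sℚ : ℕ → ℕ → ℚ
sℚ m k = ℤtoℚ (stir1 m k)

Sℚ : ℕ → ℕ → ℚ
Sℚ n j = ℕtoℚ (stir2 n j)

stir1-vanish : ∀ m k → m < k → stir1 m k ≡ + 0
stir1-vanish zero    (suc k) _         = refl
stir1-vanish (suc m) (suc k) (s≤s m<k)
  rewrite stir1-vanish m k m<k | stir1-vanish m (suc k) (ℕP.m<n⇒m<1+n m<k) =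
  cong (λ z → + 0 ℤ.- z) (ℤP.*-zeroʳ (+ m))

stir2-vanish : ∀ n j → n < j → stir2 n j ≡ 0
stir2-vanish zero    (suc j) _         = refl
stir2-vanish (suc n) (suc j) (s≤s n<j)
  rewrite stir2-vanish n (suc j) (ℕP.m<n⇒m<1+n n<j) | stir2-vanish n j n<j =
  trans (ℕP.+-identityʳ _) (ℕP.*-zeroʳ (suc j))

-- s(m,0) = 0 unless m = 0, so m·s(m,0) always vanishes.
m*s[m,0]≡0 : ∀ m → ℕtoℚ m * sℚ m 0 ≡ 0ℚ
m*s[m,0]≡0 zero    = refl
m*s[m,0]≡0 (suc m) = ℚP.*-zeroʳ (ℕtoℚ (suc m))

sℚ-rec : ∀ m k → sℚ (suc m) (suc k) ≡ sℚ m k ⊖ ℕtoℚ m * sℚ m (suc k)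
sℚ-rec m k = trans (ℤtoℚ-- (stir1 m k) (+ m ℤ.* stir1 m (suc k))) (cong (sℚ m k ⊖_) (ℤtoℚ-* (+ m) (stir1 m (suc k))))

Sℚ-rec : ∀ n j → Sℚ (suc n) (suc j) ≡ ℕtoℚ (suc j) * Sℚ n (suc j) ⊕ Sℚ n j
Sℚ-rec n j = trans (ℕtoℚ-+ (suc j ℕ.* stir2 n (suc j)) (stir2 n j)) (cong (_⊕ Sℚ n j) (ℕtoℚ-* (suc j) (stir2 n (suc j))))

-- Multiplying Σ_k s(m,k) x^k by (x - m): the coefficient recurrence of
-- s, summed against an arbitrary sequence f.

stir1-step : ∀ m (f : ℕ → ℚ) →
  sumTo (suc m) (λ k → sℚ (suc m) k * f k)
    ≡ sumTo m (λ k → sℚ m k * f (suc k)) ⊖ ℕtoℚ m * sumTo m (λ k → sℚ m k * f k)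
stir1-step m f = begin
  sumTo (suc m) (λ k → sℚ (suc m) k * f k)
    ≡⟨ sumTo-shift m (λ k → sℚ (suc m) k * f k) ⟩
  0ℚ * f 0 ⊕ sumTo m (λ k → sℚ (suc m) (suc k) * f (suc k))
    ≡⟨ cong₂ _⊕_ (ℚP.*-zeroˡ (f 0)) (sumTo-cong m (λ k _ → term k)) ⟩
  0ℚ ⊕ sumTo m (λ k → sℚ m k * f (suc k) ⊖ ℕtoℚ m * g (suc k))
    ≡⟨ trans (ℚP.+-identityˡ _) (sumTo-- m _ _) ⟩
  sumTo m (λ k → sℚ m k * f (suc k)) ⊖ sumTo m (λ k → ℕtoℚ m * g (suc k))
    ≡⟨ cong (sumTo m (λ k → sℚ m k * f (suc k)) ⊖_) (trans (sumTo-*l m (ℕtoℚ m) _) tail) ⟩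
  sumTo m (λ k → sℚ m k * f (suc k)) ⊖ ℕtoℚ m * sumTo m g ∎
  where
  g : ℕ → ℚ
  g k = sℚ m k * f k
  term : ∀ k → sℚ (suc m) (suc k) * f (suc k) ≡ sℚ m k * f (suc k) ⊖ ℕtoℚ m * g (suc k)
  term k = trans (cong (_* f (suc k)) (sℚ-rec m k))
    (qsolve 4 (λ s a t x → (s :- a :* t) :* x := s :* x :- a :* (t :* x)) refl
      (sℚ m k) (ℕtoℚ m) (sℚ m (suc k)) (f (suc k)))
  topVanishes : g (suc m) ≡ 0ℚ
  topVanishes = trans (cong (λ z → ℤtoℚ z * f (suc m)) (stir1-vanish m (suc m) ℕP.≤-refl)) (ℚP.*-zeroˡ (f (suc m)))
  tail : ℕtoℚ m * sumTo m (λ k → g (suc k)) ≡ ℕtoℚ m * sumTo m g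
  tail = begin
    ℕtoℚ m * sumTo m (λ k → g (suc k))  ≡⟨ cong (ℕtoℚ m *_) (sumTo-shiftDown m g topVanishes) ⟩
    ℕtoℚ m * (sumTo m g ⊖ sℚ m 0 * f 0)
      ≡⟨ qsolve 4 (λ a t s x → a :* (t :- s :* x) := a :* t :- (a :* s) :* x) refl (ℕtoℚ m) (sumTo m g) (sℚ m 0) (f 0) ⟩
    ℕtoℚ m * sumTo m g ⊖ (ℕtoℚ m * sℚ m 0) * f 0  ≡⟨ cong (λ z → ℕtoℚ m * sumTo m g ⊖ z * f 0) (m*s[m,0]≡0 m) ⟩
    ℕtoℚ m * sumTo m g ⊖ 0ℚ * f 0
      ≡⟨ qsolve 2 (λ y x → y :- con 0ℚ :* x := y) refl (ℕtoℚ m * sumTo m g) (f 0) ⟩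
    ℕtoℚ m * sumTo m g ∎

binomWeight : ℕ → ℕ → ℕ → ℚ
binomWeight r n j = ℕtoℚ ((n C j) ℕ.* r ^ (n ∸ j))

binomSum : ℕ → ℕ → (ℕ → ℚ) → ℚ
binomSum r n g = sumTo n (λ j → binomWeight r n j * g j)

binomWeight-zero : ∀ r n → binomWeight r (suc n) 0 ≡ ℕtoℚ r * binomWeight r n 0
binomWeight-zero r n = trans (cong ℕtoℚ (reassoc r (r ^ n))) (ℕtoℚ-* r (1 ℕ.* r ^ n))
  where
  reassoc : ∀ r q → 1 ℕ.* (r ℕ.* q) ≡ r ℕ.* (1 ℕ.* q)
  reassoc = ℕSolver.solve-∀

binomWeight-top : ∀ r n → binomWeight r n (suc n) ≡ 0ℚ
binomWeight-top r n = cong (λ c → ℕtoℚ (c ℕ.* r ^ (n ∸ suc n))) (k>n⇒nCk≡0 {n} {suc n} ℕP.≤-refl)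

power-peel : ∀ r n j → j < n → r ^ (n ∸ j) ≡ r ℕ.* r ^ (n ∸ suc j)
power-peel r (suc n) zero    _         = refl
power-peel r (suc n) (suc j) (s≤s j<n) = power-peel r n j j<n

-- C(n,j+1) r^(n-j) = r · C(n,j+1) r^(n-j-1); when j ≥ n both sides are 0.
binom-peel-r : ∀ r n j → (n C suc j) ℕ.* r ^ (n ∸ j) ≡ r ℕ.* ((n C suc j) ℕ.* r ^ (n ∸ suc j))
binom-peel-r r n j with j ℕP.<? n
... | yes j<n rewrite power-peel r n j j<n = reassoc (n C suc j) r (r ^ (n ∸ suc j))
  where
  reassoc : ∀ c r q → c ℕ.* (r ℕ.* q) ≡ r ℕ.* (c ℕ.* q)
  reassoc = ℕSolver.solve-∀
... | no j≮n rewrite k>n⇒nCk≡0 {n} {suc j} (s≤s (ℕP.≮⇒≥ j≮n)) = sym (ℕP.*-zeroʳ r)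

binomWeight-pascal : ∀ r n j → binomWeight r (suc n) (suc j) ≡ binomWeight r n j ⊕ ℕtoℚ r * binomWeight r n (suc j)
binomWeight-pascal r n j = begin
  ℕtoℚ ((suc n C suc j) ℕ.* r ^ (n ∸ j))
    ≡⟨ cong (λ c → ℕtoℚ (c ℕ.* r ^ (n ∸ j))) (sym (nCk+nC[k+1]≡[n+1]C[k+1] n j)) ⟩
  ℕtoℚ ((n C j + n C suc j) ℕ.* r ^ (n ∸ j))
    ≡⟨ cong ℕtoℚ (trans (ℕP.*-distribʳ-+ (r ^ (n ∸ j)) (n C j) (n C suc j)) (cong (λ y → (n C j) ℕ.* r ^ (n ∸ j) + y) (binom-peel-r r n j))) ⟩
  ℕtoℚ ((n C j) ℕ.* r ^ (n ∸ j) + r ℕ.* ((n C suc j) ℕ.* r ^ (n ∸ suc j)))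
    ≡⟨ trans (ℕtoℚ-+ ((n C j) ℕ.* r ^ (n ∸ j)) (r ℕ.* ((n C suc j) ℕ.* r ^ (n ∸ suc j))))
             (cong (binomWeight r n j ⊕_) (ℕtoℚ-* r ((n C suc j) ℕ.* r ^ (n ∸ suc j)))) ⟩
  binomWeight r n j ⊕ ℕtoℚ r * binomWeight r n (suc j) ∎

-- Pascal's rule summed: the convolution for n+1 is r times the one for n
-- plus the convolution of the shifted sequence g(·+1).  (For generating
-- functions: (e^{rz} G(z))' = r e^{rz} G(z) + e^{rz} G'(z).)
binomSum-step : ∀ r n (g : ℕ → ℚ) → binomSum r (suc n) g ≡ ℕtoℚ r * binomSum r n g ⊕ binomSum r n (λ j → g (suc j))
binomSum-step r n g = begin
  binomSum r (suc n) g
    ≡⟨ sumTo-shift n (λ j → binomWeight r (suc n) j * g j) ⟩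
  binomWeight r (suc n) 0 * g 0 ⊕ sumTo n (λ j → binomWeight r (suc n) (suc j) * g (suc j))
    ≡⟨ cong₂ _⊕_ first (trans (sumTo-cong n (λ j _ → term j)) (sumTo-+ n _ _)) ⟩
  ℕtoℚ r * h 0 ⊕ (binomSum r n (λ j → g (suc j)) ⊕ sumTo n (λ j → ℕtoℚ r * h (suc j)))
    ≡⟨ cong (λ x → ℕtoℚ r * h 0 ⊕ (binomSum r n (λ j → g (suc j)) ⊕ x))
            (trans (sumTo-*l n (ℕtoℚ r) _) (cong (ℕtoℚ r *_) (sumTo-shiftDown n h topVanishes))) ⟩
  ℕtoℚ r * h 0 ⊕ (binomSum r n (λ j → g (suc j)) ⊕ ℕtoℚ r * (binomSum r n g ⊖ h 0))
    ≡⟨ qsolve 4 (λ a t u w → a :* t :+ (u :+ a :* (w :- t)) := a :* w :+ u) refl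
         (ℕtoℚ r) (h 0) (binomSum r n (λ j → g (suc j))) (binomSum r n g) ⟩
  ℕtoℚ r * binomSum r n g ⊕ binomSum r n (λ j → g (suc j)) ∎
  where
  h : ℕ → ℚ
  h j = binomWeight r n j * g j
  first : binomWeight r (suc n) 0 * g 0 ≡ ℕtoℚ r * h 0
  first = trans (cong (_* g 0) (binomWeight-zero r n)) (ℚP.*-assoc (ℕtoℚ r) (binomWeight r n 0) (g 0))
  term : ∀ j → binomWeight r (suc n) (suc j) * g (suc j) ≡ binomWeight r n j * g (suc j) ⊕ ℕtoℚ r * h (suc j)
  term j = trans (cong (_* g (suc j)) (binomWeight-pascal r n j))
    (qsolve 4 (λ b a c x → (b :+ a :* c) :* x := b :* x :+ a :* (c :* x)) refl
      (binomWeight r n j) (ℕtoℚ r) (binomWeight r n (suc j)) (g (suc j)))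
  topVanishes : h (suc n) ≡ 0ℚ
  topVanishes = trans (cong (_* g (suc n)) (binomWeight-top r n)) (ℚP.*-zeroˡ (g (suc n)))

-- The array T(m,n,j) = Σ_k s(m,k) S(n+k,j): the coefficient of the
-- falling factorial (x)_j in x^n (x)_m.

fallCoeff : ℕ → ℕ → ℕ → ℚ
fallCoeff m n j = sumTo m (λ k → sℚ m k * Sℚ (n + k) j)

fallCoeff-suc-n-zero : ∀ m n → fallCoeff m (suc n) 0 ≡ 0ℚ
fallCoeff-suc-n-zero m n = sumTo-zero m _ (λ k → ℚP.*-zeroʳ (sℚ m k))

fallCoeff-suc-n : ∀ m n j → fallCoeff m (suc n) (suc j) ≡ ℕtoℚ (suc j) * fallCoeff m n (suc j) ⊕ fallCoeff m n j
fallCoeff-suc-n m n j = begin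
  fallCoeff m (suc n) (suc j)
    ≡⟨ sumTo-cong m (λ k _ → term k) ⟩
  sumTo m (λ k → ℕtoℚ (suc j) * (sℚ m k * Sℚ (n + k) (suc j)) ⊕ sℚ m k * Sℚ (n + k) j)
    ≡⟨ sumTo-+ m _ _ ⟩
  sumTo m (λ k → ℕtoℚ (suc j) * (sℚ m k * Sℚ (n + k) (suc j))) ⊕ fallCoeff m n j
    ≡⟨ cong (_⊕ fallCoeff m n j) (sumTo-*l m (ℕtoℚ (suc j)) _) ⟩
  ℕtoℚ (suc j) * fallCoeff m n (suc j) ⊕ fallCoeff m n j ∎
  where
  term : ∀ k → sℚ m k * Sℚ (suc n + k) (suc j) ≡ ℕtoℚ (suc j) * (sℚ m k * Sℚ (n + k) (suc j)) ⊕ sℚ m k * Sℚ (n + k) j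
  term k = trans (cong (sℚ m k *_) (Sℚ-rec (n + k) j))
    (qsolve 4 (λ s a b c → s :* (a :* b :+ c) := a :* (s :* b) :+ s :* c) refl
      (sℚ m k) (ℕtoℚ (suc j)) (Sℚ (n + k) (suc j)) (Sℚ (n + k) j))

-- Recurrence in m: x^n (x)_{m+1} = x^{n+1} (x)_m - m x^n (x)_m.
fallCoeff-suc-m : ∀ m n j → fallCoeff (suc m) n j ≡ fallCoeff m (suc n) j ⊖ ℕtoℚ m * fallCoeff m n j
fallCoeff-suc-m m n j = trans (stir1-step m (λ k → Sℚ (n + k) j))
  (cong (_⊖ ℕtoℚ m * fallCoeff m n j) (sumTo-cong m (λ k _ → cong (λ i → sℚ m k * Sℚ i j) (ℕP.+-suc n k))))

fallCoeff-suc-suc : ∀ m n j →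
  fallCoeff (suc m) n (suc j) ≡ ℕtoℚ (suc j) * fallCoeff m n (suc j) ⊕ fallCoeff m n j ⊖ ℕtoℚ m * fallCoeff m n (suc j)
fallCoeff-suc-suc m n j = trans (fallCoeff-suc-m m n (suc j)) (cong (_⊖ ℕtoℚ m * fallCoeff m n (suc j)) (fallCoeff-suc-n m n j))

fallCoeff-vanish : ∀ m n j → j < m → fallCoeff m n j ≡ 0ℚ
fallCoeff-vanish (suc zero) n zero _ =
  trans (fallCoeff-suc-m 0 n 0) (cong₂ _⊖_ (fallCoeff-suc-n-zero 0 n) (ℚP.*-zeroˡ (fallCoeff 0 n 0)))
fallCoeff-vanish (suc (suc m)) n zero _ = trans (fallCoeff-suc-m (suc m) n 0) (cong₂ _⊖_ (fallCoeff-suc-n-zero (suc m) n)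
  (trans (cong (ℕtoℚ (suc m) *_) (fallCoeff-vanish (suc m) n 0 (s≤s z≤n))) (ℚP.*-zeroʳ (ℕtoℚ (suc m)))))
fallCoeff-vanish (suc m) n (suc j) (s≤s j<m) with ℕP.m≤n⇒m<n∨m≡n j<m
... | inj₁ 1+j<m = begin
  fallCoeff (suc m) n (suc j)                ≡⟨ fallCoeff-suc-suc m n j ⟩
  ℕtoℚ (suc j) * fallCoeff m n (suc j) ⊕ fallCoeff m n j ⊖ ℕtoℚ m * fallCoeff m n (suc j)
    ≡⟨ cong₂ (λ x y → ℕtoℚ (suc j) * x ⊕ y ⊖ ℕtoℚ m * x) (fallCoeff-vanish m n (suc j) 1+j<m) (fallCoeff-vanish m n j j<m) ⟩
  ℕtoℚ (suc j) * 0ℚ ⊕ 0ℚ ⊖ ℕtoℚ m * 0ℚ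
    ≡⟨ qsolve 2 (λ a b → a :* con 0ℚ :+ con 0ℚ :- b :* con 0ℚ := con 0ℚ) refl (ℕtoℚ (suc j)) (ℕtoℚ m) ⟩
  0ℚ ∎
... | inj₂ refl = begin
  fallCoeff (suc m) n (suc j)                ≡⟨ fallCoeff-suc-suc m n j ⟩
  ℕtoℚ m * fallCoeff m n m ⊕ fallCoeff m n j ⊖ ℕtoℚ m * fallCoeff m n m
    ≡⟨ cong (λ y → ℕtoℚ m * fallCoeff m n m ⊕ y ⊖ ℕtoℚ m * fallCoeff m n m) (fallCoeff-vanish m n j ℕP.≤-refl) ⟩
  ℕtoℚ m * fallCoeff m n m ⊕ 0ℚ ⊖ ℕtoℚ m * fallCoeff m n m
    ≡⟨ qsolve 2 (λ a b → a :* b :+ con 0ℚ :- a :* b := con 0ℚ) refl (ℕtoℚ m) (fallCoeff m n m) ⟩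
  0ℚ ∎

-- For n = 0 this is the orthogonality Σ_k s(m,k) S(k,m+i) = δ_{i,0}.
fallCoeff-base : ∀ m i → fallCoeff m 0 (m + i) ≡ Sℚ 0 i
fallCoeff-base zero    i = ℚP.*-identityˡ (Sℚ 0 i)
fallCoeff-base (suc m) i = begin
  fallCoeff (suc m) 0 (suc (m + i))          ≡⟨ fallCoeff-suc-suc m 0 (m + i) ⟩
  ℕtoℚ (suc (m + i)) * fallCoeff m 0 (suc (m + i)) ⊕ fallCoeff m 0 (m + i) ⊖ ℕtoℚ m * fallCoeff m 0 (suc (m + i))
    ≡⟨ cong₂ (λ x y → ℕtoℚ (suc (m + i)) * x ⊕ y ⊖ ℕtoℚ m * x)
             (trans (cong (fallCoeff m 0) (sym (ℕP.+-suc m i))) (fallCoeff-base m (suc i))) (fallCoeff-base m i) ⟩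
  ℕtoℚ (suc (m + i)) * 0ℚ ⊕ Sℚ 0 i ⊖ ℕtoℚ m * 0ℚ
    ≡⟨ qsolve 3 (λ a b d → a :* con 0ℚ :+ d :- b :* con 0ℚ := d) refl (ℕtoℚ (suc (m + i))) (ℕtoℚ m) (Sℚ 0 i) ⟩
  Sℚ 0 i ∎

rStirℚ : ℕ → ℕ → ℕ → ℚ
rStirℚ r n k = binomSum r n (λ j → Sℚ j k)

rStir≡rStirℚ : ∀ r n k → ℕtoℚ (rStir r n k) ≡ rStirℚ r n k
rStir≡rStirℚ r n k = partial n
  where
  weight : ℕ → ℕ
  weight j = (n C j) ℕ.* r ^ (n ∸ j)
  partial : ∀ J → ℕtoℚ (rStirSum r n k J) ≡ sumTo J (λ j → binomWeight r n j * Sℚ j k)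
  partial zero    = ℕtoℚ-* (weight 0) (stir2 0 k)
  partial (suc J) = trans (ℕtoℚ-+ (rStirSum r n k J) (weight (suc J) ℕ.* stir2 (suc J) k))
                          (cong₂ _⊕_ (partial J) (ℕtoℚ-* (weight (suc J)) (stir2 (suc J) k)))

rStirℚ-zero : ∀ r i → rStirℚ r 0 i ≡ Sℚ 0 i
rStirℚ-zero r i = ℚP.*-identityˡ (Sℚ 0 i)

rStirℚ-suc-zero : ∀ r n → rStirℚ r (suc n) 0 ≡ ℕtoℚ r * rStirℚ r n 0
rStirℚ-suc-zero r n = trans (binomSum-step r n (λ j → Sℚ j 0))
  (trans (cong (ℕtoℚ r * rStirℚ r n 0 ⊕_) (sumTo-zero n _ (λ j → ℚP.*-zeroʳ (binomWeight r n j)))) (ℚP.+-identityʳ _))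

rStirℚ-suc-suc : ∀ r n k → rStirℚ r (suc n) (suc k) ≡ ℕtoℚ (suc (r + k)) * rStirℚ r n (suc k) ⊕ rStirℚ r n k
rStirℚ-suc-suc r n k = begin
  rStirℚ r (suc n) (suc k)
    ≡⟨ binomSum-step r n (λ j → Sℚ j (suc k)) ⟩
  ℕtoℚ r * rStirℚ r n (suc k) ⊕ binomSum r n (λ j → Sℚ (suc j) (suc k))
    ≡⟨ cong (ℕtoℚ r * rStirℚ r n (suc k) ⊕_) shifted ⟩
  ℕtoℚ r * rStirℚ r n (suc k) ⊕ (ℕtoℚ (suc k) * rStirℚ r n (suc k) ⊕ rStirℚ r n k)
    ≡⟨ qsolve 4 (λ a b w v → a :* w :+ (b :* w :+ v) := (a :+ b) :* w :+ v) refl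
         (ℕtoℚ r) (ℕtoℚ (suc k)) (rStirℚ r n (suc k)) (rStirℚ r n k) ⟩
  (ℕtoℚ r ⊕ ℕtoℚ (suc k)) * rStirℚ r n (suc k) ⊕ rStirℚ r n k
    ≡⟨ cong (λ c → c * rStirℚ r n (suc k) ⊕ rStirℚ r n k) (trans (sym (ℕtoℚ-+ r (suc k))) (cong ℕtoℚ (ℕP.+-suc r k))) ⟩
  ℕtoℚ (suc (r + k)) * rStirℚ r n (suc k) ⊕ rStirℚ r n k ∎
  where
  term : ∀ j → binomWeight r n j * Sℚ (suc j) (suc k)
             ≡ ℕtoℚ (suc k) * (binomWeight r n j * Sℚ j (suc k)) ⊕ binomWeight r n j * Sℚ j k
  term j = trans (cong (binomWeight r n j *_) (Sℚ-rec j k))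
    (qsolve 4 (λ w a b c → w :* (a :* b :+ c) := a :* (w :* b) :+ w :* c) refl
      (binomWeight r n j) (ℕtoℚ (suc k)) (Sℚ j (suc k)) (Sℚ j k))
  shifted : binomSum r n (λ j → Sℚ (suc j) (suc k)) ≡ ℕtoℚ (suc k) * rStirℚ r n (suc k) ⊕ rStirℚ r n k
  shifted = trans (sumTo-cong n (λ j _ → term j))
    (trans (sumTo-+ n _ _) (cong (_⊕ rStirℚ r n k) (sumTo-*l n (ℕtoℚ (suc k)) _)))

-- Induction on n, comparing
-- the two recurrences; the bottom entry uses the vanishing of T below m.

fallCoeff≡rStir : ∀ m n i → fallCoeff m n (m + i) ≡ rStirℚ m n i
fallCoeff≡rStir m zero i = trans (fallCoeff-base m i) (sym (rStirℚ-zero m i))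
fallCoeff≡rStir m (suc n) (suc i) = begin
  fallCoeff m (suc n) (m + suc i)        ≡⟨ cong (fallCoeff m (suc n)) (ℕP.+-suc m i) ⟩
  fallCoeff m (suc n) (suc (m + i))      ≡⟨ fallCoeff-suc-n m n (m + i) ⟩
  ℕtoℚ (suc (m + i)) * fallCoeff m n (suc (m + i)) ⊕ fallCoeff m n (m + i)
    ≡⟨ cong₂ (λ x y → ℕtoℚ (suc (m + i)) * x ⊕ y)
             (trans (cong (fallCoeff m n) (sym (ℕP.+-suc m i))) (fallCoeff≡rStir m n (suc i))) (fallCoeff≡rStir m n i) ⟩
  ℕtoℚ (suc (m + i)) * rStirℚ m n (suc i) ⊕ rStirℚ m n i ≡⟨ sym (rStirℚ-suc-suc m n i) ⟩
  rStirℚ m (suc n) (suc i) ∎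
fallCoeff≡rStir zero (suc n) zero =
  trans (fallCoeff-suc-n-zero 0 n) (sym (trans (rStirℚ-suc-zero 0 n) (ℚP.*-zeroˡ (rStirℚ 0 n 0))))
fallCoeff≡rStir (suc m) (suc n) zero = begin
  fallCoeff (suc m) (suc n) (suc (m + 0))   ≡⟨ fallCoeff-suc-n (suc m) n (m + 0) ⟩
  ℕtoℚ (suc (m + 0)) * fallCoeff (suc m) n (suc (m + 0)) ⊕ fallCoeff (suc m) n (m + 0)
    ≡⟨ cong₂ (λ x y → ℕtoℚ (suc (m + 0)) * x ⊕ y) (fallCoeff≡rStir (suc m) n 0) (fallCoeff-vanish (suc m) n (m + 0) m+0<1+m) ⟩
  ℕtoℚ (suc (m + 0)) * rStirℚ (suc m) n 0 ⊕ 0ℚ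
    ≡⟨ trans (ℚP.+-identityʳ _) (cong (λ x → ℕtoℚ (suc x) * rStirℚ (suc m) n 0) (ℕP.+-identityʳ m)) ⟩
  ℕtoℚ (suc m) * rStirℚ (suc m) n 0         ≡⟨ sym (rStirℚ-suc-zero (suc m) n) ⟩
  rStirℚ (suc m) (suc n) 0 ∎
  where
  m+0<1+m : m + 0 < suc m
  m+0<1+m = s≤s (ℕP.≤-reflexive (ℕP.+-identityʳ m))

pBell-extend : ∀ n p N → n ≤ N → pBell n p ≡ sumTo N (λ j → Sℚ n j * invℕ ((j + p) C p))
pBell-extend n p N n≤N = sym (sumTo-extend (λ j → Sℚ n j * invℕ ((j + p) C p)) n≤N
  (λ j n<j → trans (cong (λ x → ℕtoℚ x * invℕ ((j + p) C p)) (stir2-vanish n j n<j)) (ℚP.*-zeroˡ (invℕ ((j + p) C p)))))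

mainTheorem3 : ∀ (n m p : ℕ) →
    sumTo m (λ k → ℤtoℚ (stir1 m k) * pBell (n + k) p)
      ≡ sumTo n (λ k → ℕtoℚ (rStir m n k) * invℕ ((m + k + p) C p))
mainTheorem3 n m p = begin
  sumTo m (λ k → sℚ m k * pBell (n + k) p)
    ≡⟨ sumTo-cong m (λ k k≤m → cong (sℚ m k *_) (pBell-extend (n + k) p (m + n) (bound k≤m))) ⟩
  sumTo m (λ k → sℚ m k * sumTo (m + n) (λ j → Sℚ (n + k) j * c j))
    ≡⟨ sumTo-interchange m (m + n) (sℚ m) (λ k j → Sℚ (n + k) j) c ⟩
  sumTo (m + n) (λ j → fallCoeff m n j * c j)
    ≡⟨ sumTo-dropZeros m n _ (λ j j<m → trans (cong (_* c j) (fallCoeff-vanish m n j j<m)) (ℚP.*-zeroˡ (c j))) ⟩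
  sumTo n (λ i → fallCoeff m n (m + i) * c (m + i))
    ≡⟨ sumTo-cong n (λ i _ → cong (_* c (m + i)) (trans (fallCoeff≡rStir m n i) (sym (rStir≡rStirℚ m n i)))) ⟩
  sumTo n (λ k → ℕtoℚ (rStir m n k) * invℕ ((m + k + p) C p)) ∎
  where
  c : ℕ → ℚ
  c j = invℕ ((j + p) C p)
  bound : ∀ {k} → k ≤ m → n + k ≤ m + n
  bound {k} k≤m = subst (n + k ≤_) (ℕP.+-comm n m) (ℕP.+-monoʳ-≤ n k≤m)
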